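{- $\mathrm{Th}(X, S_{1} \sqcup S_{2}) = \mathrm{Th}(X, S_{1}) \cap \mathrm{Th}(X, S_{2})$. More explicitly, for any set $X$ of $\mathcal{L}$-Henkin sequents and any $\mathcal{L}$-Henkin sequents $S_1, S_2, S$: \[ X, S_{1} \sqcup S_{2} \vdash_{\mathcal{ST}^{H}} S \iff X, S_{1} \vdash_{\mathcal{ST}^{H}} S \text{ and } X, S_{2} \vdash_{\mathcal{ST}^{H}} S. \]
   Context: $\mathcal{L}$ is a first-order signature (relation and function symbols of finite arity, at least one relation symbol). Its Henkin expansion $\mathrm{Hen}(\mathcal{L})$ is obtained by iteratively adding, for each universal formula $\forall x\,\varphi$ (resp. existential formula $\exists x\,\varphi$), a new constant $\mathrm{w}(\forall x\,\varphi)$ (resp. $\mathrm{w}(\exists x\,\varphi)$), and taking the union over all iterations. $\mathcal{L}$-Henkin sequents are pairs $\Gamma \vartriangleright \Delta$ of finite sets of $\mathrm{Hen}(\mathcal{L})$-formulas. The calculus $\mathcal{ST}^{H}$ has: Identity $\varphi \vartriangleright \varphi$; Weakening on both sides; the propositional rules for $\land,\lor,\lnot$ on both sides of the classical sequent calculus, each usable both top-down and bottom-up (inverses included); witness introduction rules (from $\varphi[x\mapsto t],\Gamma\vartriangleright\Delta$ infer $\varphi[x\mapsto \mathrm{w}(\forall x\,\varphi)],\Gamma\vartriangleright\Delta$; from $\Gamma\vartriangleright\Delta,\varphi[x\mapsto t]$ infer $\Gamma\vartriangleright\Delta,\varphi[x\mapsto \mathrm{w}(\exists x\,\varphi)]$);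 witness elimination rules (from $\varphi[x\mapsto \mathrm{w}(\exists x\,\varphi)],\Gamma\vartriangleright\Delta$ infer $\varphi[x\mapsto t],\Gamma\vartriangleright\Delta$; from $\Gamma\vartriangleright\Delta,\varphi[x\mapsto \mathrm{w}(\forall x\,\varphi)]$ infer $\Gamma\vartriangleright\Delta,\varphi[x\mapsto t]$); and bidirectional quantifier rules replacing $Qx\,\varphi$ on either side by $\varphi[x\mapsto \mathrm{w}(Qx\,\varphi)]$ on the same side ($Q\in\{\forall,\exists\}$), with no eigenvariable conditions. $X \vdash_{\mathcal{ST}^{H}} S$ means $S$ is derivable from $X$ in $\mathcal{ST}^{H}$. $\mathrm{Th}(X)$ denotes the set of all $\mathcal{L}$-Henkin sequents derivable from $X$ (the theory generated by $X$). Notation: $(\Gamma_{1} \vartriangleright \Delta_{1}) \sqcup (\Gamma_{2} \vartriangleright \Delta_{2}) := \Gamma_{1}, \Gamma_{2} \vartriangleright \Delta_{1}, \Delta_{2}$. -}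

module Defs where

open import Level using (0ℓ)
open import Data.Nat using (ℕ; zero; suc; _+_; compare; less; equal; greater)
open import Data.List using (List; []; _∷_; [_]; _++_)
open import Data.Vec using (Vec; []; _∷_)
open import Data.List.Relation.Binary.BagAndSetEquality using (_∼[_]_; set)
open import Relation.Unary using (Pred; _∈_)

record Signature : Set₁ where
  field
    Rel     : Set
    Fun     : Set
    relAr   : Rel → ℕ
    funAr   : Fun → ℕ
    someRel : Rel

open Signature

data Quant : Set where
  ∀Q ∃Q : Quant

-- Variables are de Bruijn
-- indices; a quantifier  quant Q φ  binds index 0 in its body φ.
-- The witness constant  wit Q φ  is  w(Q x φ)  (φ is the body of Q x φ).
-- Since every Hen(L)-formula is built from finitely many constants, the union
-- over the iterated expansions is exactly this mutually inductive syntax.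
module _ (L : Signature) where
  mutual
    data Term : Set where
      var : ℕ → Term
      app : (f : Fun L) → Vec Term (funAr L f) → Term
      wit : Quant → Formula → Term

    data Formula : Set where
      rel   : (r : Rel L) → Vec Term (relAr L r) → Formula
      _∧'_  : Formula → Formula → Formula
      _∨'_  : Formula → Formula → Formula
      ¬'_   : Formula → Formula
      quant : Quant → Formula → Formula

module _ {L : Signature} where
  -- shifting free variables ≥ c up by one (witness constants are closed/atomic)
  mutual
    shiftT : ℕ → Term L → Term L
    shiftT c (var i) with compare i c
    ... | less _ _    = var i
    ... | equal _     = var (suc i)
    ... | greater _ _ = var (suc i)
    shiftT c (app f ts) = app f (shiftTs c ts)
    shiftT c (wit Q φ)  = wit Q φ

    shiftTs : ∀ {n} → ℕ → Vec (Term L) n → Vec (Term L) n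
    shiftTs c []       = []
    shiftTs c (t ∷ ts) = shiftT c t ∷ shiftTs c ts

  -- capture-avoiding substitution of t for variable k (and lowering of the
  -- variables above k, since the binder of k disappears)
  mutual
    substT : ℕ → Term L → Term L → Term L
    substT k t (var i) with compare i k
    ... | less _ _      = var i
    ... | equal _       = t
    ... | greater _ j   = var (k + j)
    substT k t (app f ts) = app f (substTs k t ts)
    substT k t (wit Q φ)  = wit Q φ

    substTs : ∀ {n} → ℕ → Term L → Vec (Term L) n → Vec (Term L) n
    substTs k t []       = []
    substTs k t (u ∷ us) = substT k t u ∷ substTs k t us

  substF : ℕ → Term L → Formula L → Formula L
  substF k t (rel r ts)  = rel r (substTs k t ts)
  substF k t (φ ∧' ψ)    = substF k t φ ∧' substF k t ψ
  substF k t (φ ∨' ψ)    = substF k t φ ∨' substF k t ψ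
  substF k t (¬' φ)      = ¬' substF k t φ
  substF k t (quant Q φ) = quant Q (substF (suc k) (shiftT 0 t) φ)

  _[x↦_] : Formula L → Term L → Formula L
  φ [x↦ t ] = substF 0 t φ

-- L-Henkin sequents: pairs of finite sets of Hen(L)-formulas, represented by
-- lists; the calculus below is closed under set-equality of the two sides.
record Sequent (L : Signature) : Set where
  constructor _▷_
  field
    ante : List (Formula L)
    succ : List (Formula L)

infix 4 _▷_

_⊔_ : ∀ {L} → Sequent L → Sequent L → Sequent L
(Γ₁ ▷ Δ₁) ⊔ (Γ₂ ▷ Δ₂) = (Γ₁ ++ Γ₂) ▷ (Δ₁ ++ Δ₂)

infix 2 _⊢_
data _⊢_ {L : Signature} (X : Pred (Sequent L) 0ℓ) : Sequent L → Set where
  hyp    : ∀ {S} → S ∈ X → X ⊢ S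
  -- sides are finite sets: derivability is invariant under set-equality
  setEq  : ∀ {Γ Γ' Δ Δ'} → Γ ∼[ set ] Γ' → Δ ∼[ set ] Δ' →
           X ⊢ (Γ ▷ Δ) → X ⊢ (Γ' ▷ Δ')
  ident  : ∀ {φ} → X ⊢ ([ φ ] ▷ [ φ ])
  weakL  : ∀ {φ Γ Δ} → X ⊢ (Γ ▷ Δ) → X ⊢ (φ ∷ Γ ▷ Δ)
  weakR  : ∀ {φ Γ Δ} → X ⊢ (Γ ▷ Δ) → X ⊢ (Γ ▷ φ ∷ Δ)
  ∧L     : ∀ {A B Γ Δ} → X ⊢ (A ∷ B ∷ Γ ▷ Δ) → X ⊢ ((A ∧' B) ∷ Γ ▷ Δ)
  ∧L⁻    : ∀ {A B Γ Δ} → X ⊢ ((A ∧' B) ∷ Γ ▷ Δ) → X ⊢ (A ∷ B ∷ Γ ▷ Δ)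
  ∧R     : ∀ {A B Γ Δ} → X ⊢ (Γ ▷ A ∷ Δ) → X ⊢ (Γ ▷ B ∷ Δ) →
           X ⊢ (Γ ▷ (A ∧' B) ∷ Δ)
  ∧R⁻₁   : ∀ {A B Γ Δ} → X ⊢ (Γ ▷ (A ∧' B) ∷ Δ) → X ⊢ (Γ ▷ A ∷ Δ)
  ∧R⁻₂   : ∀ {A B Γ Δ} → X ⊢ (Γ ▷ (A ∧' B) ∷ Δ) → X ⊢ (Γ ▷ B ∷ Δ)
  ∨L     : ∀ {A B Γ Δ} → X ⊢ (A ∷ Γ ▷ Δ) → X ⊢ (B ∷ Γ ▷ Δ) →
           X ⊢ ((A ∨' B) ∷ Γ ▷ Δ)
  ∨L⁻₁   : ∀ {A B Γ Δ} → X ⊢ ((A ∨' B) ∷ Γ ▷ Δ) → X ⊢ (A ∷ Γ ▷ Δ)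
  ∨L⁻₂   : ∀ {A B Γ Δ} → X ⊢ ((A ∨' B) ∷ Γ ▷ Δ) → X ⊢ (B ∷ Γ ▷ Δ)
  ∨R     : ∀ {A B Γ Δ} → X ⊢ (Γ ▷ A ∷ B ∷ Δ) → X ⊢ (Γ ▷ (A ∨' B) ∷ Δ)
  ∨R⁻    : ∀ {A B Γ Δ} → X ⊢ (Γ ▷ (A ∨' B) ∷ Δ) → X ⊢ (Γ ▷ A ∷ B ∷ Δ)
  ¬L     : ∀ {A Γ Δ} → X ⊢ (Γ ▷ A ∷ Δ) → X ⊢ ((¬' A) ∷ Γ ▷ Δ)
  ¬L⁻    : ∀ {A Γ Δ} → X ⊢ ((¬' A) ∷ Γ ▷ Δ) → X ⊢ (Γ ▷ A ∷ Δ)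
  ¬R     : ∀ {A Γ Δ} → X ⊢ (A ∷ Γ ▷ Δ) → X ⊢ (Γ ▷ (¬' A) ∷ Δ)
  ¬R⁻    : ∀ {A Γ Δ} → X ⊢ (Γ ▷ (¬' A) ∷ Δ) → X ⊢ (A ∷ Γ ▷ Δ)
  witIntroL : ∀ {φ t Γ Δ} → X ⊢ (φ [x↦ t ] ∷ Γ ▷ Δ) →
              X ⊢ (φ [x↦ wit ∀Q φ ] ∷ Γ ▷ Δ)
  witIntroR : ∀ {φ t Γ Δ} → X ⊢ (Γ ▷ φ [x↦ t ] ∷ Δ) →
              X ⊢ (Γ ▷ φ [x↦ wit ∃Q φ ] ∷ Δ)
  witElimL  : ∀ {φ t Γ Δ} → X ⊢ (φ [x↦ wit ∃Q φ ] ∷ Γ ▷ Δ) →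
              X ⊢ (φ [x↦ t ] ∷ Γ ▷ Δ)
  witElimR  : ∀ {φ t Γ Δ} → X ⊢ (Γ ▷ φ [x↦ wit ∀Q φ ] ∷ Δ) →
              X ⊢ (Γ ▷ φ [x↦ t ] ∷ Δ)
  -- bidirectional quantifier rules (no eigenvariable conditions)
  quantL    : ∀ {Q φ Γ Δ} → X ⊢ (quant Q φ ∷ Γ ▷ Δ) →
              X ⊢ (φ [x↦ wit Q φ ] ∷ Γ ▷ Δ)
  quantL⁻   : ∀ {Q φ Γ Δ} → X ⊢ (φ [x↦ wit Q φ ] ∷ Γ ▷ Δ) →
              X ⊢ (quant Q φ ∷ Γ ▷ Δ)
  quantR    : ∀ {Q φ Γ Δ} → X ⊢ (Γ ▷ quant Q φ ∷ Δ) →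
              X ⊢ (Γ ▷ φ [x↦ wit Q φ ] ∷ Δ)
  quantR⁻   : ∀ {Q φ Γ Δ} → X ⊢ (Γ ▷ φ [x↦ wit Q φ ] ∷ Δ) →
              X ⊢ (Γ ▷ quant Q φ ∷ Δ)

-- A derivation from hypotheses Y can be run side by side with an extra context
-- C: every rule instance stays a rule instance after adding C to both sides, so
-- if each hypothesis T of Y yields T ⊔ C from Z, then Y ⊢ S gives Z ⊢ S ⊔ C.
-- With C empty, S₁ ⊔ S₂ is a weakening of S₁ (and of S₂), hence derivable from
-- either.  Conversely, carrying S₂ through a derivation from S₁ yields S ⊔ S₂
-- from S₁ ⊔ S₂; carrying S through a derivation from S₂ then yields S ⊔ S,
-- which is S because the sides of a sequent are sets.
module Submission where

open import Defs
open import Level using (0ℓ)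
open import Data.Product using (_×_; _,_)
open import Function.Bundles using (_⇔_; mk⇔)
open import Relation.Unary using (Pred; _∪_; ｛_｝; _∈_; _⊆_)
open import Data.Sum using (inj₁; inj₂)
open import Data.List using ([]; _∷_)
open import Data.List.Relation.Binary.BagAndSetEquality
  using (set; commutativeMonoid; ++-idempotent)
open import Algebra.Bundles using (CommutativeMonoid)
open import Relation.Binary.PropositionalEquality using (refl)

module _ {L : Signature} where

  private
    module SetEq = CommutativeMonoid (commutativeMonoid set (Formula L))

  ∅ : Sequent L
  ∅ = [] ▷ []

  module _ {Z : Pred (Sequent L) 0ℓ} where

    ⊔-comm : ∀ S T → Z ⊢ S ⊔ T → Z ⊢ T ⊔ S
    ⊔-comm (Γ ▷ Δ) (Γ' ▷ Δ') = setEq (SetEq.comm Γ Γ') (SetEq.comm Δ Δ')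

    ⊔-identityʳ : ∀ {S} → Z ⊢ S ⊔ ∅ → Z ⊢ S
    ⊔-identityʳ {Γ ▷ Δ} = setEq (SetEq.identityʳ Γ) (SetEq.identityʳ Δ)

    ⊔-idem : ∀ {S} → Z ⊢ S ⊔ S → Z ⊢ S
    ⊔-idem {Γ ▷ Δ} = setEq (++-idempotent Γ) (++-idempotent Δ)

    weaken-⊔ˡ : ∀ {S} C → Z ⊢ S → Z ⊢ C ⊔ S
    weaken-⊔ˡ ([] ▷ [])    d = d
    weaken-⊔ˡ ([] ▷ φ ∷ Δ) d = weakR (weaken-⊔ˡ ([] ▷ Δ) d)
    weaken-⊔ˡ (φ ∷ Γ ▷ Δ)  d = weakL (weaken-⊔ˡ (Γ ▷ Δ) d)

    weaken-⊔ʳ : ∀ {S} C → Z ⊢ S → Z ⊢ S ⊔ C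
    weaken-⊔ʳ {S} C d = ⊔-comm C S (weaken-⊔ˡ C d)

  ⊢-lift-⊔ : ∀ {Y Z : Pred (Sequent L) 0ℓ} {S} C →
             (∀ {T} → T ∈ Y → Z ⊢ T ⊔ C) → Y ⊢ S → Z ⊢ S ⊔ C
  ⊢-lift-⊔ C h (hyp p)        = h p
  ⊢-lift-⊔ (Γ ▷ Δ) h (setEq g e d) =
    setEq (SetEq.∙-cong g (SetEq.refl {Γ})) (SetEq.∙-cong e (SetEq.refl {Δ}))
          (⊢-lift-⊔ (Γ ▷ Δ) h d)
  ⊢-lift-⊔ C h ident          = weaken-⊔ʳ C ident
  ⊢-lift-⊔ C h (weakL d)      = weakL (⊢-lift-⊔ C h d)
  ⊢-lift-⊔ C h (weakR d)      = weakR (⊢-lift-⊔ C h d)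
  ⊢-lift-⊔ C h (∧L d)         = ∧L (⊢-lift-⊔ C h d)
  ⊢-lift-⊔ C h (∧L⁻ d)        = ∧L⁻ (⊢-lift-⊔ C h d)
  ⊢-lift-⊔ C h (∧R d e)       = ∧R (⊢-lift-⊔ C h d) (⊢-lift-⊔ C h e)
  ⊢-lift-⊔ C h (∧R⁻₁ d)       = ∧R⁻₁ (⊢-lift-⊔ C h d)
  ⊢-lift-⊔ C h (∧R⁻₂ d)       = ∧R⁻₂ (⊢-lift-⊔ C h d)
  ⊢-lift-⊔ C h (∨L d e)       = ∨L (⊢-lift-⊔ C h d) (⊢-lift-⊔ C h e)
  ⊢-lift-⊔ C h (∨L⁻₁ d)       = ∨L⁻₁ (⊢-lift-⊔ C h d)
  ⊢-lift-⊔ C h (∨L⁻₂ d)       = ∨L⁻₂ (⊢-lift-⊔ C h d)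
  ⊢-lift-⊔ C h (∨R d)         = ∨R (⊢-lift-⊔ C h d)
  ⊢-lift-⊔ C h (∨R⁻ d)        = ∨R⁻ (⊢-lift-⊔ C h d)
  ⊢-lift-⊔ C h (¬L d)         = ¬L (⊢-lift-⊔ C h d)
  ⊢-lift-⊔ C h (¬L⁻ d)        = ¬L⁻ (⊢-lift-⊔ C h d)
  ⊢-lift-⊔ C h (¬R d)         = ¬R (⊢-lift-⊔ C h d)
  ⊢-lift-⊔ C h (¬R⁻ d)        = ¬R⁻ (⊢-lift-⊔ C h d)
  ⊢-lift-⊔ C h (witIntroL d)  = witIntroL (⊢-lift-⊔ C h d)
  ⊢-lift-⊔ C h (witIntroR d)  = witIntroR (⊢-lift-⊔ C h d)
  ⊢-lift-⊔ C h (witElimL d)   = witElimL (⊢-lift-⊔ C h d)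
  ⊢-lift-⊔ C h (witElimR d)   = witElimR (⊢-lift-⊔ C h d)
  ⊢-lift-⊔ C h (quantL d)     = quantL (⊢-lift-⊔ C h d)
  ⊢-lift-⊔ C h (quantL⁻ d)    = quantL⁻ (⊢-lift-⊔ C h d)
  ⊢-lift-⊔ C h (quantR d)     = quantR (⊢-lift-⊔ C h d)
  ⊢-lift-⊔ C h (quantR⁻ d)    = quantR⁻ (⊢-lift-⊔ C h d)

  replaceHyp-⊔ : ∀ {X Z : Pred (Sequent L) 0ℓ} {A S} C → X ⊆ Z →
                 Z ⊢ A ⊔ C → X ∪ ｛ A ｝ ⊢ S → Z ⊢ S ⊔ C
  replaceHyp-⊔ C X⊆Z a = ⊢-lift-⊔ C λ where
    (inj₁ T∈X)  → weaken-⊔ʳ C (hyp (X⊆Z T∈X))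
    (inj₂ refl) → a

  replaceHyp : ∀ {X Z : Pred (Sequent L) 0ℓ} {A S} → X ⊆ Z →
               Z ⊢ A → X ∪ ｛ A ｝ ⊢ S → Z ⊢ S
  replaceHyp X⊆Z a d = ⊔-identityʳ (replaceHyp-⊔ ∅ X⊆Z (weaken-⊔ʳ ∅ a) d)

mainTheorem9 : (L : Signature) (X : Pred (Sequent L) 0ℓ) (S₁ S₂ S : Sequent L) →
    ((X ∪ ｛ S₁ ⊔ S₂ ｝) ⊢ S) ⇔ (((X ∪ ｛ S₁ ｝) ⊢ S) × ((X ∪ ｛ S₂ ｝) ⊢ S))
mainTheorem9 L X S₁ S₂ S = mk⇔
  (λ d → replaceHyp inj₁ (weaken-⊔ʳ S₂ S₁-hyp) d
       , replaceHyp inj₁ (weaken-⊔ˡ S₁ S₂-hyp) d)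
  (λ (d₁ , d₂) →
    let S⊔S₂ = replaceHyp-⊔ S₂ inj₁ (hyp (inj₂ refl)) d₁
    in  ⊔-idem (replaceHyp-⊔ S inj₁ (⊔-comm S S₂ S⊔S₂) d₂))
  where
  S₁-hyp : X ∪ ｛ S₁ ｝ ⊢ S₁
  S₁-hyp = hyp (inj₂ refl)
  S₂-hyp : X ∪ ｛ S₂ ｝ ⊢ S₂
  S₂-hyp = hyp (inj₂ refl)
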